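{- Let $\mathfrak{X}=(X,\{R_{i}\}_{i=0}^{d})$ be a commutative association scheme generated by a non-symmetric relation $R_1$ with $R_{1}^{2}\subseteq\{R_{1},R_{1^{*}},R_{2}\}$, $R_{1}R_{1^{*}}\subseteq\{R_{0},R_{1},R_{1^{*}},R_{2},R_{2^{*}}\}$, $2\notin\{1^*,2^*\}$ and $k_1=k_2>1$. Let $I=\{i\mid R_i\in R_1^2\}$ and $J=\{i\mid R_i\in R_1R_{1^*}\}$. Then for all $x,z\in X$, \[P_{1,1}(x,z)\times P_{1,1^*}(x,z)\subseteq\bigcup_{j\in I\cap J}R_j .\]
   Context: Association scheme notation: $R(x)=\{y\mid (x,y)\in R\}$; $R_{i^*}=R_i^T$; $P_{i,j}(x,y)=R_i(x)\cap R_{j^*}(y)=\{w:(x,w)\in R_i,(w,y)\in R_j\}$; $p^l_{i,j}=|P_{i,j}(x,y)|$ for $(x,y)\in R_l$; $k_i=p^0_{i,i^*}$; commutative means $p^l_{i,j}=p^l_{j,i}$. For sets $E,F$ of relations, $EF=\{R_l\mid\sum_{R_i\in E,R_j\in F}p^l_{i,j}\neq0\}$, $R_iR_j=\{R_i\}\{R_j\}$, $R_1^2=R_1R_1$. $R_1$ generates $\mathfrak{X}$ if the smallest set $F$ of relations containing $R_1$ with $R_{i^*}R_j\subseteq F$ for all $R_i,R_j\in F$ is all of $\{R_i\}_{i=0}^d$. -}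

module Defs where

open import Data.Nat using (ℕ; zero; suc; _<_)
open import Data.Fin using (Fin; zero; suc)
open import Data.Fin.Properties using (_≟_)
open import Data.List using (List; length; filter)
open import Data.Product using (Σ; _×_; _,_; ∃-syntax)
open import Data.Sum using (_⊎_)
open import Relation.Nullary.Decidable using (_×-dec_)
open import Relation.Binary.PropositionalEquality using (_≡_)
open import Function.Bundles using (_⇔_)
import Data.Fin as F

allX : (n : ℕ) → List (Fin n)
allX n = Data.List.allFin n
  where import Data.List

-- An association scheme on X = Fin n with relations R_0,…,R_d indexed by Fin (suc d).
-- The relations partition X × X: (x,y) ∈ R_i  iff  rel x y ≡ i.
record Scheme (n d : ℕ) : Set where
  field
    rel  : Fin n → Fin n → Fin (suc d)
    star : Fin (suc d) → Fin (suc d)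
    rel0      : ∀ x y → (rel x y ≡ zero) ⇔ (x ≡ y)
    transpose : ∀ x y → rel y x ≡ star (rel x y)
    nonempty  : ∀ i → ∃[ x ] ∃[ y ] rel x y ≡ i

  P : Fin (suc d) → Fin (suc d) → Fin n → Fin n → Fin n → Set
  P i j x y w = (rel x w ≡ i) × (rel w y ≡ j)

  count : Fin (suc d) → Fin (suc d) → Fin n → Fin n → ℕ
  count i j x y = length (filter (λ w → (rel x w ≟ i) ×-dec (rel w y ≟ j)) (allX n))

  -- valency k_i = p^0_{i,i*}, computed at the base point (x,x) ∈ R_0
  k : Fin (suc d) → Fin n → ℕ
  k i x = count i (star i) x x

  -- R_l ∈ R_i R_j  iff  p^l_{i,j} ≠ 0, i.e. P_{i,j}(x,y) ≠ ∅ for (x,y) ∈ R_l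
  InProd : Fin (suc d) → Fin (suc d) → Fin (suc d) → Set
  InProd i j l = ∃[ x ] ∃[ y ] ∃[ w ] (rel x y ≡ l × P i j x y w)

  -- R_1 generates: the smallest F ∋ R_1 with R_{i*}R_j ⊆ F (i,j ∈ F) is everything
  GeneratedBy : Fin (suc d) → Set₁
  GeneratedBy r = (F : Fin (suc d) → Set) → F r →
    (∀ i j l → F i → F j → InProd (star i) j l → F l) → ∀ l → F l

record IsAssocScheme {n d : ℕ} (S : Scheme n d) : Set where
  open Scheme S
  field
    -- p^l_{i,j} is well defined
    regular : ∀ i j x y x' y' → rel x y ≡ rel x' y' → count i j x y ≡ count i j x' y'

IsCommutative : {n d : ℕ} → Scheme n d → Set
IsCommutative S = ∀ i j x y → count i j x y ≡ count j i x y
  where open Scheme S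

module Submission where

open import Defs
open import Data.Nat using (ℕ; _<_) renaming (suc to 1+)
open import Data.Fin using (Fin; zero; suc)
open import Data.List using (List; _∷_; length; filter)
open import Data.List.Membership.Propositional using (_∈_)
open import Data.List.Membership.Propositional.Properties using (∈-filter⁺; ∈-filter⁻; ∈-allFin; ∈-length)
open import Data.List.Relation.Unary.Any using (here)
open import Data.Product using (_×_; _,_; proj₂; ∃; ∃-syntax)
open import Data.Sum using (_⊎_)
open import Relation.Binary.PropositionalEquality using (_≡_; _≢_; refl; sym; trans; subst)
open import Relation.Nullary.Decidable using (_×-dec_)
open import Relation.Unary using (Decidable)
open import Data.Fin.Properties using (_≟_)

-- If y ∈ P_{1,1}(x,z) and y' ∈ P_{1,1*}(x,z), then z is a midpoint of
-- a path y →R₁ z →R₁ y', and x a midpoint of a path y →R₁* x →R₁ y'; commutativity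
-- turns the latter into a path of type R₁R₁*.

0<length⇒∈ : ∀ {A : Set} (xs : List A) → 0 < length xs → ∃[ a ] a ∈ xs
0<length⇒∈ (a ∷ _) _ = a , here refl

module SchemeProperties {n d : ℕ} (S : Scheme n d) where
  open Scheme S

  rel-transpose : ∀ {x y i} → rel x y ≡ i → rel y x ≡ star i
  rel-transpose {x} {y} refl = transpose x y

  -- transpose only constrains star on indices that occur, hence nonempty.
  star-involutive : ∀ i → star (star i) ≡ i
  star-involutive i with nonempty i
  ... | x , y , refl = sym (rel-transpose (rel-transpose refl))

  rel-transpose-star : ∀ {x y i} → rel x y ≡ star i → rel y x ≡ i
  rel-transpose-star {i = i} xy = trans (rel-transpose xy) (star-involutive i)

  P? : ∀ i j a b → Decidable (P i j a b)
  P? i j a b w = (rel a w ≟ i) ×-dec (rel w b ≟ j)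

  P⇒0<count : ∀ {i j a b w} → P i j a b w → 0 < count i j a b
  P⇒0<count {i} {j} {a} {b} {w} p = ∈-length (∈-filter⁺ (P? i j a b) (∈-allFin w) p)

  0<count⇒P : ∀ {i j a b} → 0 < count i j a b → ∃ (P i j a b)
  0<count⇒P {i} {j} {a} {b} pos with 0<length⇒∈ (filter (P? i j a b) (allX n)) pos
  ... | w , w∈ = w , proj₂ (∈-filter⁻ (P? i j a b) {xs = allX n} w∈)

  P-swap : IsCommutative S → ∀ {i j a b w} → P i j a b w → ∃ (P j i a b)
  P-swap comm {i} {j} {a} {b} p = 0<count⇒P (subst (0 <_) (comm i j a b) (P⇒0<count p))

lemma3p5 : {n d : ℕ} (S : Scheme n (1+ (1+ d))) → IsAssocScheme S → IsCommutative S →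
    let open Scheme S
        r1 : Fin (1+ (1+ (1+ d)))
        r1 = suc zero
        r2 : Fin (1+ (1+ (1+ d)))
        r2 = suc (suc zero)
    in GeneratedBy r1 →
       star r1 ≢ r1 →
       (∀ l → InProd r1 r1 l → l ≡ r1 ⊎ l ≡ star r1 ⊎ l ≡ r2) →
       (∀ l → InProd r1 (star r1) l →
          l ≡ zero ⊎ l ≡ r1 ⊎ l ≡ star r1 ⊎ l ≡ r2 ⊎ l ≡ star r2) →
       r2 ≢ star r1 → r2 ≢ star r2 →
       (∀ x → k r1 x ≡ k r2 x) → (∀ x → 1 < k r1 x) →
       ∀ x z y y' → P r1 r1 x z y → P r1 (star r1) x z y' →
         InProd r1 r1 (rel y y') × InProd r1 (star r1) (rel y y')
lemma3p5 S _ comm _ _ _ _ _ _ _ _ x z y y' (xy , yz) (xy' , y'z) =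
  (y , y' , z , refl , yz , zy') , (y , y' , via-R₁R₁*)
  where
  open Scheme S
  open SchemeProperties S

  zy' : rel z y' ≡ suc zero
  zy' = rel-transpose-star y'z

  yx : rel y x ≡ star (suc zero)
  yx = rel-transpose xy

  via-R₁R₁* : ∃[ w ] (rel y y' ≡ rel y y' × P (suc zero) (star (suc zero)) y y' w)
  via-R₁R₁* with P-swap comm (yx , xy')
  ... | w , p = w , refl , p
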